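{- No infinite betweenness algebra $\langle A,f,g\rangle$ is a mixed algebra; that is, if $A$ is infinite then $Q_f\neq S_g$.
   Context: $A$ is a non-trivial Boolean algebra ($+,\cdot,-,0,1$); $\mathrm{Ult}(A)$ its ultrafilters. A PS-algebra has $f:A^2\to A$ with $f(0,y)=f(x,0)=0$ and additive in each argument and $g:A^2\to A$ with $g(0,y)=g(x,0)=1$, $g(x+x',y)=g(x,y)\cdot g(x',y)$, $g(x,y+y')=g(x,y)\cdot g(x,y')$. A betweenness algebra is a PS-algebra satisfying for all $x,y,z$: $x\le f(x,x)$; $f(x,y)\le f(y,x)$; $g(x,y)\le g(y,x)$; $y\cdot f(x,z)\le f(x\cdot f(x,y),z)$; $f(x,g(x,-y)\cdot y)\le y$; and $x\ne0\wedge y\ne0\to g(x,y)\le f(x,y)$. On $\mathrm{Ult}(A)$: $Q_f(u_1,u_2,u_3)$ iff $f[u_1\times u_3]\subseteq u_2$; $S_g(u_1,u_2,u_3)$ iff $g[u_1\times u_3]\cap u_2\ne\emptyset$. The algebra is a mixed algebra (MIA) if $Q_f=S_g$. -}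

module Defs where

open import Level using (Level; _⊔_; suc)
open import Data.Nat using (ℕ)
open import Data.Fin using (Fin)
open import Data.Product using (Σ; _×_; ∃; ∃-syntax; _,_)
open import Data.Sum using (_⊎_)
open import Relation.Nullary using (¬_)
open import Relation.Unary using (Pred; _∈_; _∉_; _⊆_)
open import Algebra.Lattice.Bundles using (BooleanAlgebra)
open import Axiom.ExcludedMiddle using (ExcludedMiddle)

module _ {c ℓ : Level} (B : BooleanAlgebra c ℓ) where
  open BooleanAlgebra B renaming (¬_ to -_; ⊤ to 𝟙; ⊥ to 𝟘)

  _≤ᴮ_ : Carrier → Carrier → Set ℓ
  x ≤ᴮ y = (x ∧ y) ≈ x

  NonTrivial : Set ℓ
  NonTrivial = ¬ (𝟘 ≈ 𝟙)

  Finite : Set (c ⊔ ℓ)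
  Finite = Σ ℕ λ n → Σ (Fin n → Carrier) λ h → (a : Carrier) → ∃[ i ] (h i ≈ a)

  Infinite : Set (c ⊔ ℓ)
  Infinite = ¬ Finite

  record PSAlgebra : Set (c ⊔ ℓ) where
    field
      f g      : Carrier → Carrier → Carrier
      f-cong   : ∀ {x x' y y'} → x ≈ x' → y ≈ y' → f x y ≈ f x' y'
      g-cong   : ∀ {x x' y y'} → x ≈ x' → y ≈ y' → g x y ≈ g x' y'
      f-0ˡ     : ∀ y → f 𝟘 y ≈ 𝟘
      f-0ʳ     : ∀ x → f x 𝟘 ≈ 𝟘
      f-addˡ   : ∀ x x' y → f (x ∨ x') y ≈ (f x y ∨ f x' y)
      f-addʳ   : ∀ x y y' → f x (y ∨ y') ≈ (f x y ∨ f x y')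
      g-0ˡ     : ∀ y → g 𝟘 y ≈ 𝟙
      g-0ʳ     : ∀ x → g x 𝟘 ≈ 𝟙
      g-addˡ   : ∀ x x' y → g (x ∨ x') y ≈ (g x y ∧ g x' y)
      g-addʳ   : ∀ x y y' → g x (y ∨ y') ≈ (g x y ∧ g x y')

  record BetweennessAlgebra : Set (c ⊔ ℓ) where
    field
      ps : PSAlgebra
    open PSAlgebra ps public
    field
      B1 : ∀ x → x ≤ᴮ f x x
      B2 : ∀ x y → f x y ≤ᴮ f y x
      B3 : ∀ x y → g x y ≤ᴮ g y x
      B4 : ∀ x y z → (y ∧ f x z) ≤ᴮ f (x ∧ f x y) z
      B5 : ∀ x y → f x (g x (- y) ∧ y) ≤ᴮ y
      B6 : ∀ x y → ¬ (x ≈ 𝟘) → ¬ (y ≈ 𝟘) → g x y ≤ᴮ f x y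

  record IsFilter (F : Pred Carrier (c ⊔ ℓ)) : Set (c ⊔ ℓ) where
    field
      resp   : ∀ {x y} → x ≈ y → x ∈ F → y ∈ F
      top    : 𝟙 ∈ F
      proper : 𝟘 ∉ F
      meet   : ∀ {x y} → x ∈ F → y ∈ F → (x ∧ y) ∈ F
      up     : ∀ {x y} → x ∈ F → x ≤ᴮ y → y ∈ F

  record IsUltrafilter (u : Pred Carrier (c ⊔ ℓ)) : Set (c ⊔ ℓ) where
    field
      filter : IsFilter u
      ultra  : ∀ x → x ∈ u ⊎ (- x) ∈ u

  Ult : Set (suc (c ⊔ ℓ))
  Ult = Σ (Pred Carrier (c ⊔ ℓ)) IsUltrafilter

  -- classical metatheory (ZFC) principles, used as explicit assumptions
  UltrafilterLemma : Set (suc (c ⊔ ℓ))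
  UltrafilterLemma = ∀ (F : Pred Carrier (c ⊔ ℓ)) → IsFilter F →
                     ∃[ u ] (IsUltrafilter u × F ⊆ u)

  module _ (P : PSAlgebra) where
    open PSAlgebra P

    Qf : Ult → Ult → Ult → Set (c ⊔ ℓ)
    Qf (u₁ , _) (u₂ , _) (u₃ , _) = ∀ x y → x ∈ u₁ → y ∈ u₃ → f x y ∈ u₂

    Sg : Ult → Ult → Ult → Set (c ⊔ ℓ)
    Sg (u₁ , _) (u₂ , _) (u₃ , _) = ∃[ x ] ∃[ y ] (x ∈ u₁ × y ∈ u₃ × g x y ∈ u₂)

    IsMixed : Set (suc (c ⊔ ℓ))
    IsMixed = ∀ u₁ u₂ u₃ → (Qf u₁ u₂ u₃ → Sg u₁ u₂ u₃) × (Sg u₁ u₂ u₃ → Qf u₁ u₂ u₃)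

module Submission where

-- Every element x ∧ y ∧ g(x,y) is an atom or 0: if p and q were disjoint nonzero
-- parts of it, then p ≤ g(p,q) ≤ f(p,q) by B6, while q ≤ g(p,p) ∧ -p makes
-- f(p,q) ≤ -p by B5, so p = 0.  Since Q_f holds on the diagonal of every
-- ultrafilter (by B1), Q_f = S_g would put such an element, hence an atom, into
-- every ultrafilter.  In an infinite Boolean algebra the cofinite (Fréchet)
-- filter is proper and extends to an ultrafilter containing no atom.

open import Defs
open import Level using (Level; _⊔_; Lift; lift; lower)
open import Relation.Nullary using (¬_; Dec; yes; no)
open import Relation.Nullary.Decidable using (map′)
open import Algebra.Lattice.Bundles using (BooleanAlgebra)
import Algebra.Lattice.Properties.BooleanAlgebra as BooleanAlgebraProperties
open import Axiom.ExcludedMiddle using (ExcludedMiddle)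
open import Data.Product using (_×_; _,_; ∃-syntax; proj₁)
open import Data.Sum using (_⊎_; inj₁; inj₂)
open import Data.Empty using (⊥; ⊥-elim)
open import Data.List using (List; []; _∷_; _++_; map; length; lookup)
open import Data.List.Relation.Unary.All using (All; []; _∷_)
open import Data.List.Relation.Unary.All.Properties using (++⁺)
open import Data.List.Relation.Unary.Any using (here; index)
open import Data.List.Relation.Unary.Any.Properties using (lookup-index)
import Data.List.Membership.Setoid as Membership
import Data.List.Membership.Setoid.Properties as MembershipProperties
import Relation.Binary.Lattice.Bundles as Order
import Relation.Binary.Lattice.Properties.JoinSemilattice as JoinSemilatticeProperties
import Relation.Binary.Reasoning.PartialOrder as ≤-Reasoning
import Relation.Binary.Reasoning.Setoid as ≈-Reasoning

module BooleanAlgebraFacts {c ℓ : Level} (B : BooleanAlgebra c ℓ) where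
  open BooleanAlgebra B renaming (¬_ to -_; ⊤ to 𝟙; ⊥ to 𝟘)
  private module Properties = BooleanAlgebraProperties B
  open Properties hiding (poset; ¬-involutive)
  open Properties public using (poset; ¬-involutive)
  open Order.Lattice ∨-∧-orderTheoreticLattice public
    using (_≤_; x≤x∨y; y≤x∨y; x∧y≤x; x∧y≤y; ∧-greatest; antisym)
    renaming (refl to ≤-refl; reflexive to ≤-reflexive; trans to ≤-trans)
  open Order.Lattice ∨-∧-orderTheoreticLattice using (joinSemilattice)
  open JoinSemilatticeProperties joinSemilattice public using (∨-monotonic; x≤y⇒x∨y≈y)
  open Membership setoid using (_∈_)
  open MembershipProperties using (∈-resp-≈; ∈-++⁺ˡ; ∈-++⁺ʳ; ∈-map⁺)

  ≤ᴮ⇒≤ : ∀ {x y} → _≤ᴮ_ B x y → x ≤ y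
  ≤ᴮ⇒≤ = sym

  ≤⇒≤ᴮ : ∀ {x y} → x ≤ y → _≤ᴮ_ B x y
  ≤⇒≤ᴮ = sym

  x≤𝟙 : ∀ x → x ≤ 𝟙
  x≤𝟙 x = sym (∧-identityʳ x)

  ≈𝟙-upward : ∀ {x y} → x ≤ y → x ≈ 𝟙 → y ≈ 𝟙
  ≈𝟙-upward {x} {y} x≤y x≈𝟙 = antisym (x≤𝟙 y) (begin
    𝟙 ≈⟨ sym x≈𝟙 ⟩
    x ≤⟨ x≤y ⟩
    y ∎)
    where open ≤-Reasoning poset

  x≤-x⇒x≈𝟘 : ∀ {x} → x ≤ - x → x ≈ 𝟘
  x≤-x⇒x≈𝟘 {x} x≤-x = trans x≤-x (∧-complementʳ x)

  complement-part-nonzero : ∀ {t a} → t ∧ a ≉ a → - t ∧ a ≉ 𝟘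
  complement-part-nonzero {t} {a} t∧a≉a -t∧a≈𝟘 = t∧a≉a (begin
    t ∧ a             ≈⟨ sym (∨-identityʳ (t ∧ a)) ⟩
    t ∧ a ∨ 𝟘         ≈⟨ ∨-congˡ (sym -t∧a≈𝟘) ⟩
    t ∧ a ∨ - t ∧ a   ≈⟨ sym (∧-distribʳ-∨ a t (- t)) ⟩
    (t ∨ - t) ∧ a     ≈⟨ ∧-congʳ (∨-complementʳ t) ⟩
    𝟙 ∧ a             ≈⟨ ∧-identityˡ a ⟩
    a                 ∎)
    where open ≈-Reasoning setoid

  complement-part-disjoint : ∀ t a → - t ∧ a ≤ - (t ∧ a)
  complement-part-disjoint t a = begin
    - t ∧ a       ≤⟨ x∧y≤x (- t) a ⟩
    - t           ≤⟨ x≤x∨y (- t) (- a) ⟩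
    - t ∨ - a     ≈⟨ sym (deMorgan₁ t a) ⟩
    - (t ∧ a)     ∎
    where open ≤-Reasoning poset

  Indivisible : Carrier → Set (c ⊔ ℓ)
  Indivisible a = ∀ t → t ∧ a ≈ 𝟘 ⊎ t ∧ a ≈ a

  Unsplittable : Carrier → Set (c ⊔ ℓ)
  Unsplittable a = ∀ t → ¬ (t ∧ a ≉ 𝟘 × t ∧ a ≉ a)

  decidable : ExcludedMiddle (c ⊔ ℓ) → (P : Set ℓ) → Dec P
  decidable em P = map′ lower lift (em {Lift c P})

  unsplittable⇒indivisible : ExcludedMiddle (c ⊔ ℓ) → ∀ {a} → Unsplittable a → Indivisible a
  unsplittable⇒indivisible em {a} unsplittable t
    with decidable em (t ∧ a ≈ 𝟘) | decidable em (t ∧ a ≈ a)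
  ... | yes t∧a≈𝟘 | _         = inj₁ t∧a≈𝟘
  ... | no _      | yes t∧a≈a = inj₂ t∧a≈a
  ... | no t∧a≉𝟘  | no t∧a≉a  = ⊥-elim (unsplittable t (t∧a≉𝟘 , t∧a≉a))

  ⋁ : List Carrier → Carrier
  ⋁ []       = 𝟘
  ⋁ (a ∷ as) = a ∨ ⋁ as

  ⋁-++ : ∀ as bs → ⋁ (as ++ bs) ≈ ⋁ as ∨ ⋁ bs
  ⋁-++ []       bs = sym (∨-identityˡ (⋁ bs))
  ⋁-++ (a ∷ as) bs = trans (∨-congˡ (⋁-++ as bs)) (sym (∨-assoc a (⋁ as) (⋁ bs)))

  joinsOfSublists : List Carrier → List Carrier
  joinsOfSublists []       = 𝟘 ∷ []
  joinsOfSublists (a ∷ as) = map (a ∨_) (joinsOfSublists as) ++ joinsOfSublists as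

  -- Below a join of indivisibles, x is the join of those that meet it.
  ∧-⋁-∈-joinsOfSublists : ∀ {as} → All Indivisible as → ∀ x → x ∧ ⋁ as ∈ joinsOfSublists as
  ∧-⋁-∈-joinsOfSublists []                     x = here (∧-zeroʳ x)
  ∧-⋁-∈-joinsOfSublists {a ∷ as} (a-ind ∷ as-ind) x =
    ∈-resp-≈ setoid (sym (∧-distribˡ-∨ x a (⋁ as))) (choose (a-ind x))
    where
    x∧⋁as∈ : x ∧ ⋁ as ∈ joinsOfSublists as
    x∧⋁as∈ = ∧-⋁-∈-joinsOfSublists as-ind x
    choose : x ∧ a ≈ 𝟘 ⊎ x ∧ a ≈ a → x ∧ a ∨ x ∧ ⋁ as ∈ joinsOfSublists (a ∷ as)
    choose (inj₁ x∧a≈𝟘) = ∈-resp-≈ setoid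
      (trans (sym (∨-identityˡ _)) (∨-congʳ (sym x∧a≈𝟘)))
      (∈-++⁺ʳ setoid (map (a ∨_) (joinsOfSublists as)) x∧⋁as∈)
    choose (inj₂ x∧a≈a) = ∈-resp-≈ setoid
      (∨-congʳ (sym x∧a≈a))
      (∈-++⁺ˡ setoid (∈-map⁺ setoid setoid ∨-congˡ x∧⋁as∈))

  indivisibles-cover⇒finite : ∀ {as} → All Indivisible as → ⋁ as ≈ 𝟙 → Finite B
  indivisibles-cover⇒finite {as} as-ind ⋁as≈𝟙 =
    length (joinsOfSublists as) , lookup (joinsOfSublists as) , λ x →
      let x∈joins = ∈-resp-≈ setoid (trans (∧-congˡ ⋁as≈𝟙) (∧-identityʳ x))
                                    (∧-⋁-∈-joinsOfSublists as-ind x)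
      in index x∈joins , sym (lookup-index x∈joins)

  Cofinite : Carrier → Set (c ⊔ ℓ)
  Cofinite x = ∃[ as ] (All Indivisible as × x ∨ ⋁ as ≈ 𝟙)

  cofinite-∧ : ∀ {x y} → Cofinite x → Cofinite y → Cofinite (x ∧ y)
  cofinite-∧ {x} {y} (as , as-ind , x∨⋁as≈𝟙) (bs , bs-ind , y∨⋁bs≈𝟙) =
    as ++ bs , ++⁺ as-ind bs-ind , (begin
      x ∧ y ∨ ⋁ (as ++ bs)      ≈⟨ ∨-congˡ (⋁-++ as bs) ⟩
      x ∧ y ∨ J                 ≈⟨ ∨-distribʳ-∧ J x y ⟩
      (x ∨ J) ∧ (y ∨ J)         ≈⟨ ∧-cong x∨J≈𝟙 y∨J≈𝟙 ⟩
      𝟙 ∧ 𝟙                     ≈⟨ ∧-identityˡ 𝟙 ⟩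
      𝟙                         ∎)
    where
    open ≈-Reasoning setoid
    J = ⋁ as ∨ ⋁ bs
    x∨J≈𝟙 : x ∨ J ≈ 𝟙
    x∨J≈𝟙 = ≈𝟙-upward (∨-monotonic ≤-refl (x≤x∨y (⋁ as) (⋁ bs))) x∨⋁as≈𝟙
    y∨J≈𝟙 : y ∨ J ≈ 𝟙
    y∨J≈𝟙 = ≈𝟙-upward (∨-monotonic ≤-refl (y≤x∨y (⋁ as) (⋁ bs))) y∨⋁bs≈𝟙

  cofinite-upward : ∀ {x y} → Cofinite x → x ≤ y → Cofinite y
  cofinite-upward (as , as-ind , x∨⋁as≈𝟙) x≤y =
    as , as-ind , ≈𝟙-upward (∨-monotonic x≤y ≤-refl) x∨⋁as≈𝟙

  cofinite-isFilter : Infinite B → IsFilter B Cofinite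
  cofinite-isFilter infinite = record
    { resp   = λ x≈y x∈F → cofinite-upward x∈F (≤-reflexive x≈y)
    ; top    = [] , [] , ∨-identityʳ 𝟙
    ; proper = λ { (as , as-ind , 𝟘∨⋁as≈𝟙) →
                 infinite (indivisibles-cover⇒finite as-ind (trans (sym (∨-identityˡ _)) 𝟘∨⋁as≈𝟙)) }
    ; meet   = cofinite-∧
    ; up     = λ x∈F x≤y → cofinite-upward x∈F (≤ᴮ⇒≤ x≤y)
    }

  ultrafilter-without-indivisibles : UltrafilterLemma B → Infinite B →
    ∃[ u ] (IsUltrafilter B u × (∀ {a} → u a → ¬ Indivisible a))
  ultrafilter-without-indivisibles ultrafilterLemma infinite
    with ultrafilterLemma Cofinite (cofinite-isFilter infinite)
  ... | u , u-ult , cofinite⊆u = u , u-ult , λ {a} a∈u a-ind →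
    proper (resp (∧-complementʳ a) (meet a∈u (cofinite⊆u (a ∷ [] , a-ind ∷ [] , -a∨a≈𝟙 a))))
    where
    open IsFilter (IsUltrafilter.filter u-ult)
    -a∨a≈𝟙 : ∀ a → - a ∨ (a ∨ 𝟘) ≈ 𝟙
    -a∨a≈𝟙 a = trans (∨-congˡ (∨-identityʳ a)) (∨-complementˡ a)

module PSAlgebraFacts {c ℓ : Level} {B : BooleanAlgebra c ℓ} (P : PSAlgebra B) where
  open BooleanAlgebra B renaming (¬_ to -_; ⊤ to 𝟙; ⊥ to 𝟘)
  open BooleanAlgebraFacts B
  open PSAlgebra P
  open ≤-Reasoning poset

  f-mono : ∀ {x x′ y y′} → x ≤ x′ → y ≤ y′ → f x y ≤ f x′ y′
  f-mono {x} {x′} {y} {y′} x≤x′ y≤y′ = begin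
    f x y               ≤⟨ x≤x∨y (f x y) (f x′ y) ⟩
    f x y ∨ f x′ y      ≈⟨ sym (f-addˡ x x′ y) ⟩
    f (x ∨ x′) y        ≈⟨ f-cong (x≤y⇒x∨y≈y x≤x′) refl ⟩
    f x′ y              ≤⟨ x≤x∨y (f x′ y) (f x′ y′) ⟩
    f x′ y ∨ f x′ y′    ≈⟨ sym (f-addʳ x′ y y′) ⟩
    f x′ (y ∨ y′)       ≈⟨ f-cong refl (x≤y⇒x∨y≈y y≤y′) ⟩
    f x′ y′             ∎

  g-anti : ∀ {x x′ y y′} → x ≤ x′ → y ≤ y′ → g x′ y′ ≤ g x y
  g-anti {x} {x′} {y} {y′} x≤x′ y≤y′ = begin
    g x′ y′             ≈⟨ g-cong (sym (x≤y⇒x∨y≈y x≤x′)) (sym (x≤y⇒x∨y≈y y≤y′)) ⟩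
    g (x ∨ x′) (y ∨ y′) ≈⟨ g-addˡ x x′ (y ∨ y′) ⟩
    g x (y ∨ y′) ∧ g x′ (y ∨ y′)  ≤⟨ x∧y≤x _ _ ⟩
    g x (y ∨ y′)        ≈⟨ g-addʳ x y y′ ⟩
    g x y ∧ g x y′      ≤⟨ x∧y≤x _ _ ⟩
    g x y               ∎

module BetweennessAlgebraFacts {c ℓ : Level} {B : BooleanAlgebra c ℓ} (BA : BetweennessAlgebra B) where
  open BooleanAlgebra B renaming (¬_ to -_; ⊤ to 𝟙; ⊥ to 𝟘)
  open BooleanAlgebraFacts B
  open BetweennessAlgebra BA
  open PSAlgebraFacts ps
  open ≤-Reasoning poset

  x∧y≤f : ∀ x y → x ∧ y ≤ f x y
  x∧y≤f x y = begin
    x ∧ y               ≤⟨ ≤ᴮ⇒≤ (B1 (x ∧ y)) ⟩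
    f (x ∧ y) (x ∧ y)   ≤⟨ f-mono (x∧y≤x x y) (x∧y≤y x y) ⟩
    f x y               ∎

  Qf-diagonal : ∀ U → Qf B ps U U U
  Qf-diagonal (u , u-ult) x y x∈u y∈u = up (meet x∈u y∈u) (≤⇒≤ᴮ (x∧y≤f x y))
    where open IsFilter (IsUltrafilter.filter u-ult)

  no-disjoint-pair : ∀ {p q} → p ≉ 𝟘 → q ≉ 𝟘 → q ≤ - p → p ≤ g p q → q ≤ g p p → ⊥
  no-disjoint-pair {p} {q} p≉𝟘 q≉𝟘 q≤-p p≤gpq q≤gpp = p≉𝟘 (x≤-x⇒x≈𝟘 (begin
    p                         ≤⟨ p≤gpq ⟩
    g p q                     ≤⟨ ≤ᴮ⇒≤ (B6 p q p≉𝟘 q≉𝟘) ⟩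
    f p q                     ≤⟨ f-mono ≤-refl (∧-greatest q≤gp--p q≤-p) ⟩
    f p (g p (- - p) ∧ - p)   ≤⟨ ≤ᴮ⇒≤ (B5 p (- p)) ⟩
    - p                       ∎))
    where
    q≤gp--p : q ≤ g p (- - p)
    q≤gp--p = ≤-trans q≤gpp (≤-reflexive (g-cong refl (sym (¬-involutive p))))

  x∧y∧g-unsplittable : ∀ x y → Unsplittable (x ∧ y ∧ g x y)
  x∧y∧g-unsplittable x y t (t∧z≉𝟘 , t∧z≉z) =
    no-disjoint-pair t∧z≉𝟘 (complement-part-nonzero t∧z≉z) (complement-part-disjoint t z)
      (below-g p≤z q≤z p≤z) (below-g p≤z p≤z q≤z)
    where
    z = x ∧ y ∧ g x y
    z≤x : z ≤ x
    z≤x = x∧y≤x x _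
    z≤y : z ≤ y
    z≤y = ≤-trans (x∧y≤y x _) (x∧y≤x y _)
    z≤gxy : z ≤ g x y
    z≤gxy = ≤-trans (x∧y≤y x _) (x∧y≤y y _)
    p≤z : t ∧ z ≤ z
    p≤z = x∧y≤y t z
    q≤z : - t ∧ z ≤ z
    q≤z = x∧y≤y (- t) z
    below-g : ∀ {r s w} → r ≤ z → s ≤ z → w ≤ z → w ≤ g r s
    below-g {r} {s} {w} r≤z s≤z w≤z = begin
      w       ≤⟨ w≤z ⟩
      z       ≤⟨ z≤gxy ⟩
      g x y   ≤⟨ g-anti (≤-trans r≤z z≤x) (≤-trans s≤z z≤y) ⟩
      g r s   ∎

  mixed⇒indivisible-in-every-ultrafilter : ExcludedMiddle (c ⊔ ℓ) → IsMixed B ps →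
    ∀ U → ∃[ a ] (proj₁ U a × Indivisible a)
  mixed⇒indivisible-in-every-ultrafilter em mixed U@(u , u-ult)
    with proj₁ (mixed U U U) (Qf-diagonal U)
  ... | x , y , x∈u , y∈u , gxy∈u =
    x ∧ y ∧ g x y , meet x∈u (meet y∈u gxy∈u) ,
    unsplittable⇒indivisible em (x∧y∧g-unsplittable x y)
    where open IsFilter (IsUltrafilter.filter u-ult)

theorem8p7 : ∀ {c ℓ : Level} → ExcludedMiddle (c ⊔ ℓ) → (B : BooleanAlgebra c ℓ) →
    UltrafilterLemma B → NonTrivial B → (BA : BetweennessAlgebra B) →
    Infinite B → ¬ IsMixed B (BetweennessAlgebra.ps BA)
theorem8p7 em B ultrafilterLemma _ BA infinite mixed
  with BooleanAlgebraFacts.ultrafilter-without-indivisibles B ultrafilterLemma infinite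
... | u , u-ult , no-indivisible
  with BetweennessAlgebraFacts.mixed⇒indivisible-in-every-ultrafilter BA em mixed (u , u-ult)
... | a , a∈u , a-indivisible = no-indivisible a∈u a-indivisible
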